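{- Let $G$ be a connected graph of order $n$. Then $F_{xt}(G)=n$ if and only if the stabilizer $\Gamma_v(G)=\{\alpha\in\Gamma(G):\alpha(v)=v\}$ of every vertex $v\in V(G)$ is trivial.
   Context: All graphs are finite and simple; throughout the paper graphs are assumed connected and symmetric (nontrivial automorphism group). $\Gamma(G)$ is the automorphism group of $G$. A set $F\subseteq V(G)$ is a fixing set if the only automorphism of $G$ fixing every vertex of $F$ is the identity. A fixatic partition of $G$ is a partition of $V(G)$ into classes each of which is a fixing set of $G$; the fixatic number $F_{xt}(G)$ is the maximum number of classes in a fixatic partition. -}

module Defs where

open import Data.Nat using (ℕ; _≤_)
open import Data.Fin using (Fin)
open import Data.Bool using (Bool; true; false)
open import Data.Product using (Σ; _×_; ∃)
open import Data.Fin.Permutation using (Permutation′; _⟨$⟩ʳ_)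
open import Relation.Binary.PropositionalEquality using (_≡_; _≢_)
open import Relation.Binary.Construct.Closure.ReflexiveTransitive using (Star)

record Graph (n : ℕ) : Set where
  field
    adj   : Fin n → Fin n → Bool
    sym   : ∀ u v → adj u v ≡ adj v u
    irrefl : ∀ v → adj v v ≡ false
open Graph public

Edge : ∀ {n} → Graph n → Fin n → Fin n → Set
Edge G u v = adj G u v ≡ true

Connected : ∀ {n} → Graph n → Set
Connected G = ∀ u v → Star (Edge G) u v

IsAutomorphism : ∀ {n} → Graph n → Permutation′ n → Set
IsAutomorphism G σ = ∀ u v → adj G (σ ⟨$⟩ʳ u) (σ ⟨$⟩ʳ v) ≡ adj G u v

IsIdentity : ∀ {n} → Permutation′ n → Set
IsIdentity σ = ∀ v → σ ⟨$⟩ʳ v ≡ v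

Symmetric : ∀ {n} → Graph n → Set
Symmetric {n} G = Σ (Permutation′ n) λ σ → IsAutomorphism G σ × Σ (Fin n) λ v → σ ⟨$⟩ʳ v ≢ v

FixingSet : ∀ {n} → Graph n → (Fin n → Set) → Set
FixingSet {n} G F = (σ : Permutation′ n) → IsAutomorphism G σ →
  (∀ v → F v → σ ⟨$⟩ʳ v ≡ v) → IsIdentity σ

-- A partition of V(G) into k (nonempty) classes, given by the class map c;
-- class i is {v | c v ≡ i}; surjectivity = every class is nonempty.
record FixaticPartition {n} (G : Graph n) (k : ℕ) : Set where
  field
    class    : Fin n → Fin k
    nonempty : ∀ i → ∃ λ v → class v ≡ i
    fixing   : ∀ i → FixingSet G (λ v → class v ≡ i)

FixaticNumberIs : ∀ {n} → Graph n → ℕ → Set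
FixaticNumberIs G k = FixaticPartition G k × (∀ m → FixaticPartition G m → m ≤ k)

TrivialStabilizer : ∀ {n} → Graph n → Fin n → Set
TrivialStabilizer {n} G v = (σ : Permutation′ n) → IsAutomorphism G σ → σ ⟨$⟩ʳ v ≡ v → IsIdentity σ

module Submission where

-- A fixatic partition with k classes is in particular a map
-- c : V(G) → Fin k hitting every class, so choosing one representative per
-- class gives an injection Fin k → V(G) and hence k ≤ n.  Moreover, if two
-- distinct vertices share a class, representatives can be chosen avoiding one
-- of them, which yields an injection into n - 1 vertices and so k < n.
-- Consequently a fixatic partition with n classes consists of singletons.
--
-- On the graph side, fixing sets are closed under enlargement, and a singleton
-- {v} is a fixing set exactly when the stabilizer Γ_v(G) is trivial.  Hence:
--  (⇒) if F_xt(G) = n, each class {v} is fixing, so every Γ_v(G) is trivial;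
--  (⇐) if every Γ_v(G) is trivial, the partition into singletons is fixatic,
--      and no fixatic partition has more than n classes.
-- Connectedness and symmetry of G are standing assumptions of the paper; the
-- argument does not use them.

open import Defs hiding (sym)
open import Data.Nat using (ℕ; suc; _≤_)
open import Data.Nat.Properties using (n≮n)
open import Data.Fin using (Fin; punchOut)
open import Data.Fin.Properties using (injective⇒≤; punchOut-injective; _≟_)
open import Data.Fin.Permutation using (_⟨$⟩ʳ_)
open import Data.Product using (∃; _,_; proj₁; proj₂)
open import Function.Bundles using (_⇔_; mk⇔)
open import Function.Definitions using (Injective)
open import Relation.Binary.PropositionalEquality
  using (_≡_; _≢_; refl; sym; trans; cong; subst)
open import Relation.Nullary using (yes; no; contradiction)

Onto : ∀ {n k} → (Fin n → Fin k) → Set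
Onto c = ∀ i → ∃ λ v → c v ≡ i

section-injective : ∀ {n k} (c : Fin n → Fin k) (r : Fin k → Fin n) →
  (∀ i → c (r i) ≡ i) → Injective _≡_ _≡_ r
section-injective c r cr {i} {j} ri≡rj = trans (sym (cr i)) (trans (cong c ri≡rj) (cr j))

-- A surjection Fin n → Fin k forces k ≤ n (pick one preimage per point).
onto⇒≤ : ∀ {n k} (c : Fin n → Fin k) → Onto c → k ≤ n
onto⇒≤ c onto = injective⇒≤ (section-injective c (λ i → proj₁ (onto i)) (λ i → proj₂ (onto i)))

-- If a surjection Fin (suc m) → Fin k identifies two distinct points, then
-- k ≤ m: preimages can be chosen avoiding w, i.e. inside a set of m points.
onto-collision⇒≤ : ∀ {m k} (c : Fin (suc m) → Fin k) → Onto c →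
  ∀ {w v} → w ≢ v → c w ≡ c v → k ≤ m
onto-collision⇒≤ {m} {k} c onto {w} {v} w≢v cw≡cv = injective⇒≤ (λ {i} {j} eq →
  section-injective c rep rep-onto (punchOut-injective (avoids i) (avoids j) eq))
  where
  -- a preimage of i that is different from w
  rep : Fin k → Fin (suc m)
  rep i with i ≟ c v
  ... | yes _ = v
  ... | no  _ = proj₁ (onto i)

  rep-onto : ∀ i → c (rep i) ≡ i
  rep-onto i with i ≟ c v
  ... | yes i≡cv = sym i≡cv
  ... | no  _    = proj₂ (onto i)

  avoids : ∀ i → w ≢ rep i
  avoids i with i ≟ c v
  ... | yes _    = w≢v
  ... | no  i≢cv = λ w≡r → i≢cv (trans (sym (proj₂ (onto i))) (trans (cong c (sym w≡r)) cw≡cv))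

onto-endo⇒injective : ∀ {n} (c : Fin n → Fin n) → Onto c → Injective _≡_ _≡_ c
onto-endo⇒injective {suc m} c onto {w} {v} cw≡cv with w ≟ v
... | yes w≡v = w≡v
... | no  w≢v = contradiction (onto-collision⇒≤ c onto w≢v cw≡cv) (n≮n m)

fixingSet-mono : ∀ {n} (G : Graph n) {F F′ : Fin n → Set} →
  (∀ v → F v → F′ v) → FixingSet G F → FixingSet G F′
fixingSet-mono G F⊆F′ fixF σ aut fixesF′ = fixF σ aut (λ v Fv → fixesF′ v (F⊆F′ v Fv))

singleton-fixing⇒trivialStabilizer : ∀ {n} (G : Graph n) v →
  FixingSet G (_≡ v) → TrivialStabilizer G v
singleton-fixing⇒trivialStabilizer G v fix σ aut σv≡v =
  fix σ aut (λ w w≡v → subst (λ x → σ ⟨$⟩ʳ x ≡ x) (sym w≡v) σv≡v)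

trivialStabilizer⇒singleton-fixing : ∀ {n} (G : Graph n) v →
  TrivialStabilizer G v → FixingSet G (_≡ v)
trivialStabilizer⇒singleton-fixing G v triv σ aut fixes = triv σ aut (fixes v refl)

fixatic-size≤order : ∀ {n k} {G : Graph n} → FixaticPartition G k → k ≤ n
fixatic-size≤order P = onto⇒≤ class nonempty
  where open FixaticPartition P

-- A fixatic partition with n classes forces every stabilizer to be trivial,
-- since its classes are singletons.
fixatic-order⇒trivialStabilizers : ∀ {n} {G : Graph n} →
  FixaticPartition G n → ∀ v → TrivialStabilizer G v
fixatic-order⇒trivialStabilizers {G = G} P v =
  singleton-fixing⇒trivialStabilizer G v
    (fixingSet-mono G (λ w → onto-endo⇒injective class nonempty) (fixing (class v)))
  where open FixaticPartition P

singletonPartition : ∀ {n} (G : Graph n) → (∀ v → TrivialStabilizer G v) →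
  FixaticPartition G n
singletonPartition G triv = record
  { class    = λ v → v
  ; nonempty = λ i → i , refl
  ; fixing   = λ i → trivialStabilizer⇒singleton-fixing G i (triv i)
  }

mainTheorem5 : (n : ℕ) (G : Graph n) → Connected G → Symmetric G →
    (FixaticNumberIs G n ⇔ (∀ (v : Fin n) → TrivialStabilizer G v))
mainTheorem5 n G _ _ = mk⇔
  (λ (P , _) → fixatic-order⇒trivialStabilizers P)
  (λ triv → singletonPartition G triv , λ m → fixatic-size≤order)
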